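{- Let $s<t$ be relatively prime positive integers and $\beta$ an $(s,t)$-core beta-set. If $\beta$ contains no element of the form $st-s-bt$ with $b$ a positive integer, then $\beta\prec\overline{\beta+s}$ and $\overline{\beta+s}$ is $(s,t)$-core. Similarly, if $\beta$ contains no element of the form $st-as-t$ with $a$ a positive integer, then $\beta\prec\overline{\beta+t}$ and $\overline{\beta+t}$ is $(s,t)$-core.
   Context: A partition is a finite non-increasing sequence of positive integers; the hook number of box $(i,j)$ ($j\le P_i$) of $P=(P_1,\dots,P_n)$ is $(P_i-j)+\#\{k>i:P_k\ge j\}+1$. $P$ is $t$-core if no hook number is divisible by $t$. A beta-set is a finite set of positive integers written decreasingly $\{\beta_1>\dots>\beta_n\}$, with associated partition $P(\beta)=(\beta_1-(n-1),\dots,\beta_n)$; it is $(s,t)$-core if $P(\beta)$ is both $s$-core and $t$-core. For partitions $P=(P_1,\dots,P_n)$, $Q=(Q_1,\dots,Q_m)$ write $P<Q$ if $n\le m$ and $P_i\le Q_i$ for $i\le n$; $\beta\prec\gamma$ means $P(\beta)<P(\gamma)$. The $(s,t)$-closure of a set $\beta$ of positive integers is $\overline{\beta}=\{x-as-bt: x\in\beta,\ a,b\ge0,\ x>as+bt\}$; $\beta+k=\{x+k:x\in\beta\}$. (The elements $st-s-bt$, $b\ge1$, form the "bottom row" and $st-as-t$, $a\ge1$, the "leftmost column" of the $(s,t)$ bead diagram.) -}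

module Defs where

open import Data.Nat using (ℕ; zero; suc; _+_; _*_; _∸_; _≤_; _<_; _>_; _≥_; _≤ᵇ_)
open import Data.Nat.Divisibility using (_∣_)
open import Data.Bool using (if_then_else_)
open import Data.List using (List; []; _∷_; length; map; drop)
open import Data.List.Relation.Unary.All using (All)
open import Data.List.Relation.Unary.Linked using (Linked)
open import Data.List.Membership.Propositional using (_∈_)
open import Data.Product using (Σ; _×_; ∃)
open import Relation.Nullary using (¬_)
open import Relation.Binary.PropositionalEquality using (_≡_)

-- A partition is represented as a list of naturals (P₁, …, Pₙ).
-- Entry at 0-based position i (0 beyond the end).
at : List ℕ → ℕ → ℕ
at []       _       = 0
at (x ∷ _)  zero    = x
at (_ ∷ xs) (suc i) = at xs i

countGe : ℕ → List ℕ → ℕ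
countGe j []       = 0
countGe j (x ∷ xs) = if j ≤ᵇ x then suc (countGe j xs) else countGe j xs

-- hook number of box (i+1, j) (row index i is 0-based, column j is 1-based):
-- (P_i - j) + #{k > i : P_k ≥ j} + 1
hook : List ℕ → ℕ → ℕ → ℕ
hook P i j = (at P i ∸ j) + countGe j (drop (suc i) P) + 1

IsCore : ℕ → List ℕ → Set
IsCore t P = ∀ i j → i < length P → 1 ≤ j → j ≤ at P i → ¬ (t ∣ hook P i j)

_⊴_ : List ℕ → List ℕ → Set
P ⊴ Q = length P ≤ length Q × (∀ i → i < length P → at P i ≤ at Q i)

IsBetaSet : List ℕ → Set
IsBetaSet β = Linked _>_ β × All (λ x → 1 ≤ x) β

partOf : List ℕ → List ℕ
partOf []       = []
partOf (x ∷ xs) = (x ∸ length xs) ∷ partOf xs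

_≺_ : List ℕ → List ℕ → Set
β ≺ γ = partOf β ⊴ partOf γ

IsSTCore : ℕ → ℕ → List ℕ → Set
IsSTCore s t β = IsCore s (partOf β) × IsCore t (partOf β)

shift : List ℕ → ℕ → List ℕ
shift β k = map (_+ k) β

InClosure : ℕ → ℕ → List ℕ → ℕ → Set
InClosure s t β y =
  Σ ℕ λ x → x ∈ β × Σ ℕ λ a → Σ ℕ λ b → (a * s + b * t < x) × (y ≡ x ∸ (a * s + b * t))

IsClosureOf : ℕ → ℕ → List ℕ → List ℕ → Set
IsClosureOf s t β γ = IsBetaSet γ × (∀ y → (y ∈ γ → InClosure s t β y) × (InClosure s t β y → y ∈ γ))

module Submission where

-- A beta-set β is t-core iff it is closed under x ↦ x − t: the hook numbers of P(β) are exactly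
-- the differences x − y with x ∈ β, y < x and y ∉ β (where y = 0 counts as a non-member).
-- So an (s,t)-core β contains no element of the semigroup ⟨s,t⟩, and the closure γ of β + s is
-- closed under subtracting s and t as soon as s, t ∉ γ. But s ∈ γ would put an element of ⟨s,t⟩
-- into β, and t ∈ γ either such an element or an element st − s − bt of the bottom row.
-- Since β + s ⊆ γ and γ ∩ (s, ∞) ⊆ β + s, the parts of P(γ) dominate those of P(β).
-- The shift by t is the same statement with s and t exchanged.

open import Defs
open import Data.Bool using (true; false; if_then_else_)
open import Data.List using (List; []; _∷_; length; map; downFrom; filter)
open import Data.List.Membership.Propositional using (_∈_; _∉_; find; lose)
open import Data.List.Membership.Propositional.Properties
  using (∈-map⁺; ∈-map⁻; ∈-filter⁺; ∈-filter⁻; ∈-downFrom⁺)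
import Data.List.Relation.Unary.All as All
open All using (All; []; _∷_)
open import Data.List.Relation.Unary.Any using (here; there; any?)
import Data.List.Relation.Unary.Linked as Linked
open Linked using (Linked; []; [-]; _∷_)
open import Data.List.Relation.Unary.Linked.Properties using (Linked⇒All; filter⁺; applyDownFrom⁺₂)
open import Data.Nat using (ℕ; zero; suc; _+_; _*_; _∸_; _≤_; _<_; _>_; _≤ᵇ_; z≤n; s≤s; s≤s⁻¹)
open import Data.Nat.Coprimality using (Coprime)
open import Data.Nat.Divisibility using (_∣_; divides; ∣-refl)
open import Data.Nat.ListAction using (sum)
open import Data.Nat.Properties
open import Data.Nat.Tactic.RingSolver using (solve-∀)
open import Data.Product using (Σ; ∃₂; _×_; _,_; proj₁; proj₂)
open import Data.Sum using (_⊎_; inj₁; inj₂)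
open import Relation.Binary using (tri<; tri≈; tri>)
open import Relation.Binary.PropositionalEquality
open import Relation.Nullary using (¬_; Dec; yes; no; contradiction)
open import Relation.Nullary.Decidable using (map′; _×-dec_)
open import Relation.Nullary.Reflects using (ofʸ; ofⁿ)
open import Data.List.Membership.DecPropositional _≟_ using (_∈?_)

countLt : ℕ → List ℕ → ℕ
countLt j []       = 0
countLt j (x ∷ xs) = if j ≤ᵇ x then countLt j xs else suc (countLt j xs)

countGe+countLt≡length : ∀ j xs → countGe j xs + countLt j xs ≡ length xs
countGe+countLt≡length j [] = refl
countGe+countLt≡length j (x ∷ xs) with j ≤ᵇ x
... | true  = cong suc (countGe+countLt≡length j xs)
... | false = trans (+-suc _ _) (cong suc (countGe+countLt≡length j xs))

countLt≤length : ∀ j xs → countLt j xs ≤ length xs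
countLt≤length j [] = z≤n
countLt≤length j (x ∷ xs) with j ≤ᵇ x
... | true  = m≤n⇒m≤1+n (countLt≤length j xs)
... | false = s≤s (countLt≤length j xs)

countLt-all : ∀ k xs → All (_≤ k) xs → countLt (suc k) xs ≡ length xs
countLt-all k [] [] = refl
countLt-all k (x ∷ xs) (x≤k ∷ xs≤k) with suc k ≤ᵇ x | ≤ᵇ-reflects-≤ (suc k) x
... | true  | ofʸ k<x = contradiction x≤k (<⇒≱ k<x)
... | false | _       = cong suc (countLt-all k xs xs≤k)

countLt-cons-≤ : ∀ {j x} xs → j ≤ x → countLt j (x ∷ xs) ≡ countLt j xs
countLt-cons-≤ {j} {x} xs j≤x with j ≤ᵇ x | ≤ᵇ-reflects-≤ j x
... | true  | _        = refl
... | false | ofⁿ j≰x = contradiction j≤x j≰x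

countLt-cons-> : ∀ {j x} xs → x < j → countLt j (x ∷ xs) ≡ suc (countLt j xs)
countLt-cons-> {j} {x} xs x<j with j ≤ᵇ x | ≤ᵇ-reflects-≤ j x
... | true  | ofʸ j≤x = contradiction j≤x (<⇒≱ x<j)
... | false | _       = refl

length-partOf : ∀ β → length (partOf β) ≡ length β
length-partOf []       = refl
length-partOf (x ∷ xs) = cong suc (length-partOf xs)

below-head : ∀ {z zs} → Linked _>_ (z ∷ zs) → All (_< z) zs
below-head [-]          = []
below-head (z>y ∷ y∷ys) = Linked⇒All (λ p q → <-trans q p) z>y y∷ys

∈-head-≤ : ∀ {g gs y} → Linked _>_ (g ∷ gs) → y ∈ g ∷ gs → y ≤ g
∈-head-≤ _   (here refl) = ≤-refl
∈-head-≤ dec (there y∈)  = <⇒≤ (All.lookup (below-head dec) y∈)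

∈-<head⇒∈tail : ∀ {g gs y} → y ∈ g ∷ gs → y < g → y ∈ gs
∈-<head⇒∈tail (here refl) y<y = contradiction y<y (<-irrefl refl)
∈-<head⇒∈tail (there y∈)  _   = y∈

beta-tail : ∀ {z zs} → IsBetaSet (z ∷ zs) → IsBetaSet zs
beta-tail (dec , _ ∷ pos) = Linked.tail dec , pos

length<head : ∀ {z zs} → IsBetaSet (z ∷ zs) → length zs < z
length<head {zs = []}    (_ , 1≤z ∷ _)         = 1≤z
length<head {zs = _ ∷ _} (z>y ∷ dec , _ ∷ pos) = ≤-<-trans (length<head (dec , pos)) z>y

length≤bound : ∀ {x} β → IsBetaSet β → All (_< x) β → length β ≤ x
length≤bound []      _ _         = z≤n
length≤bound (_ ∷ _) b (z<x ∷ _) = ≤-trans (length<head b) (<⇒≤ z<x)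

partOf-bound : ∀ {x} β → IsBetaSet β → All (_< x) β → All (λ e → e + length β ≤ x) (partOf β)
partOf-bound     []       _ _         = []
partOf-bound {x} (z ∷ zs) b (z<x ∷ _) =
  first ∷ All.map rest (partOf-bound zs (beta-tail b) (below-head (proj₁ b)))
  where
  n : ℕ
  n = length zs
  first : z ∸ n + suc n ≤ x
  first = ≤-trans (≤-reflexive (trans (+-suc (z ∸ n) n) (cong suc (m∸n+n≡m (<⇒≤ (length<head b)))))) z<x
  rest : ∀ {e} → e + n ≤ z → e + suc n ≤ x
  rest {e} e+n≤z = ≤-trans (≤-reflexive (+-suc e n)) (≤-trans (s≤s e+n≤z) z<x)

-- The k-th natural number outside β, counting from 0 (and counting 0 itself): the number of
-- members of β below it is the number of parts of P(β) that are at most k.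
nonMember : List ℕ → ℕ → ℕ
nonMember β k = countLt (suc k) (partOf β) + k

nonMember≤ : ∀ β k → nonMember β k ≤ length β + k
nonMember≤ β k = +-monoˡ-≤ k (≤-trans (countLt≤length (suc k) (partOf β)) (≤-reflexive (length-partOf β)))

nonMember-beyond : ∀ β k → All (_≤ k) (partOf β) → nonMember β k ≡ length β + k
nonMember-beyond β k parts≤k = cong (_+ k) (trans (countLt-all k (partOf β) parts≤k) (length-partOf β))

nonMember-≥ : ∀ {x} β k → IsBetaSet β → All (_< x) β → x ≤ k + length β → x ≤ nonMember β k
nonMember-≥ {x} β k b β<x x≤ =
  ≤-trans x≤ (≤-reflexive (trans (+-comm k (length β)) (sym (nonMember-beyond β k parts≤k))))
  where
  parts≤k : All (_≤ k) (partOf β)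
  parts≤k = All.map (λ {e} e+n≤x → +-cancelʳ-≤ (length β) e k (≤-trans e+n≤x x≤))
                    (partOf-bound β b β<x)

nonMember-top : ∀ β y → IsBetaSet β → All (_< y) β → nonMember β (y ∸ length β) ≡ y
nonMember-top β y b β<y =
  trans (nonMember-beyond β (y ∸ length β) parts≤) (m+[n∸m]≡n (length≤bound β b β<y))
  where
  parts≤ : All (_≤ y ∸ length β) (partOf β)
  parts≤ = All.map (λ {e} → m+n≤o⇒m≤o∸n e) (partOf-bound β b β<y)

nonMember-cons-≤ : ∀ z zs k → suc k ≤ z ∸ length zs → nonMember (z ∷ zs) k ≡ nonMember zs k
nonMember-cons-≤ z zs k le = cong (_+ k) (countLt-cons-≤ (partOf zs) le)

nonMember-cons-> : ∀ z zs k → z ∸ length zs < suc k → nonMember (z ∷ zs) k ≡ suc (nonMember zs k)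
nonMember-cons-> z zs k lt = cong (_+ k) (countLt-cons-> (partOf zs) lt)

nonMember-< : ∀ z zs k → length zs ≤ z → suc k ≤ z ∸ length zs → nonMember zs k < z
nonMember-< z zs k n≤z le = ≤-<-trans (nonMember≤ zs k)
  (≤-trans (≤-reflexive (trans (sym (+-suc (length zs) k)) (+-comm (length zs) (suc k))))
           (m≤o∸n⇒m+n≤o (suc k) n≤z le))

nonMember-≥-head : ∀ z zs k → IsBetaSet (z ∷ zs) → ¬ (suc k ≤ z ∸ length zs) → z ≤ nonMember zs k
nonMember-≥-head z zs k b k≮ = nonMember-≥ zs k (beta-tail b) (below-head (proj₁ b)) z≤k+n
  where
  z≤k+n : z ≤ k + length zs
  z≤k+n = ≤-trans (m≤n+m∸n z (length zs))
            (≤-trans (+-monoʳ-≤ (length zs) (s≤s⁻¹ (≰⇒> k≮))) (≤-reflexive (+-comm (length zs) k)))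

nonMember-∉ : ∀ β k → IsBetaSet β → nonMember β k ∉ β
nonMember-∉ []       k _ ()
nonMember-∉ (z ∷ zs) k b with suc k ≤? z ∸ length zs
... | yes le = subst (_∉ z ∷ zs) (sym (nonMember-cons-≤ z zs k le)) below-z
  where
  nm<z : nonMember zs k < z
  nm<z = nonMember-< z zs k (<⇒≤ (length<head b)) le
  below-z : nonMember zs k ∉ z ∷ zs
  below-z nm∈ = nonMember-∉ zs k (beta-tail b) (∈-<head⇒∈tail nm∈ nm<z)
... | no k≮ = subst (_∉ z ∷ zs) (sym (nonMember-cons-> z zs k (≰⇒> k≮))) above-z
  where
  above-z : suc (nonMember zs k) ∉ z ∷ zs
  above-z nm∈ = <⇒≱ (s≤s (nonMember-≥-head z zs k b k≮)) (∈-head-≤ (proj₁ b) nm∈)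

nonMember-onto : ∀ β y → IsBetaSet β → y ∉ β → Σ ℕ λ k → nonMember β k ≡ y
nonMember-onto []       y _ _ = y , refl
nonMember-onto (z ∷ zs) y b y∉ with <-cmp y z
... | tri≈ _ y≡z _ = contradiction (here y≡z) y∉
... | tri> _ _ z<y =
  y ∸ length (z ∷ zs) ,
  nonMember-top (z ∷ zs) y b (z<y ∷ All.map (λ p → <-trans p z<y) (below-head (proj₁ b)))
... | tri< y<z _ _ with nonMember-onto zs y (beta-tail b) (λ y∈ → y∉ (there y∈))
...   | k , nm≡y with suc k ≤? z ∸ length zs
...     | yes le = k , trans (nonMember-cons-≤ z zs k le) nm≡y
...     | no k≮  = contradiction (subst (z ≤_) nm≡y (nonMember-≥-head z zs k b k≮)) (<⇒≱ y<z)

hook-head : ∀ z zs k → length zs ≤ z → suc k ≤ z ∸ length zs →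
            hook (partOf (z ∷ zs)) 0 (suc k) ≡ z ∸ nonMember zs k
hook-head z zs k n≤z le = trans (sym (m+n∸n≡m _ (nonMember zs k))) (cong (_∸ nonMember zs k) row)
  where
  open ≡-Reasoning
  n c d : ℕ
  n = length zs
  c = countGe (suc k) (partOf zs)
  d = countLt (suc k) (partOf zs)
  regroup : ∀ A c d k → A + c + 1 + (d + k) ≡ (A + suc k) + (c + d)
  regroup = solve-∀
  c+d≡n : c + d ≡ n
  c+d≡n = trans (countGe+countLt≡length (suc k) (partOf zs)) (length-partOf zs)
  row : hook (partOf (z ∷ zs)) 0 (suc k) + nonMember zs k ≡ z
  row = begin
    (z ∸ n ∸ suc k) + c + 1 + (d + k)  ≡⟨ regroup (z ∸ n ∸ suc k) c d k ⟩
    (z ∸ n ∸ suc k + suc k) + (c + d)  ≡⟨ cong₂ _+_ (m∸n+n≡m le) c+d≡n ⟩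
    (z ∸ n) + n                        ≡⟨ m∸n+n≡m n≤z ⟩
    z                                  ∎

BetaCore : ℕ → List ℕ → Set
BetaCore t β = ∀ {x y} → x ∈ β → y < x → y ∉ β → ¬ t ∣ x ∸ y

isCore-tail : ∀ {t z zs} → IsCore t (partOf (z ∷ zs)) → IsCore t (partOf zs)
isCore-tail core i j i< = core (suc i) j (s≤s i<)

betaCore-tail : ∀ {t z zs} → Linked _>_ (z ∷ zs) → BetaCore t (z ∷ zs) → BetaCore t zs
betaCore-tail dec core x∈ y<x y∉ = core (there x∈) y<x y∉zzs
  where
  y∉zzs : _ ∉ _ ∷ _
  y∉zzs y∈ = y∉ (∈-<head⇒∈tail y∈ (<-trans y<x (All.lookup (below-head dec) x∈)))

isCore⇒betaCore : ∀ {t} β → IsBetaSet β → IsCore t (partOf β) → BetaCore t β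
isCore⇒betaCore (z ∷ zs) b core (there x∈) y<x y∉ =
  isCore⇒betaCore zs (beta-tail b) (isCore-tail core) x∈ y<x (λ y∈ → y∉ (there y∈))
isCore⇒betaCore {t} (z ∷ zs) b core {y = y} (here refl) y<z y∉ t∣z∸y
  with nonMember-onto zs y (beta-tail b) (λ y∈ → y∉ (there y∈))
... | k , nm≡y with suc k ≤? z ∸ length zs
...   | no k≮  = <⇒≱ y<z (subst (z ≤_) nm≡y (nonMember-≥-head z zs k b k≮))
...   | yes le = core 0 (suc k) (s≤s z≤n) (s≤s z≤n) le (subst (t ∣_) z∸y≡hook t∣z∸y)
  where
  z∸y≡hook : z ∸ y ≡ hook (partOf (z ∷ zs)) 0 (suc k)
  z∸y≡hook = sym (trans (hook-head z zs k (<⇒≤ (length<head b)) le) (cong (z ∸_) nm≡y))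

betaCore⇒isCore : ∀ {t} β → IsBetaSet β → BetaCore t β → IsCore t (partOf β)
betaCore⇒isCore {t} (z ∷ zs) b core zero (suc k) _ _ le t∣hook =
  core (here refl) nm<z nm∉ (subst (t ∣_) (hook-head z zs k (<⇒≤ (length<head b)) le) t∣hook)
  where
  nm<z : nonMember zs k < z
  nm<z = nonMember-< z zs k (<⇒≤ (length<head b)) le
  nm∉ : nonMember zs k ∉ z ∷ zs
  nm∉ nm∈ = nonMember-∉ zs k (beta-tail b) (∈-<head⇒∈tail nm∈ nm<z)
betaCore⇒isCore (z ∷ zs) b core (suc i) j i< =
  betaCore⇒isCore zs (beta-tail b) (betaCore-tail (proj₁ b) core) i j (s≤s⁻¹ i<)

DownClosed : ℕ → List ℕ → Set
DownClosed k β = ∀ {x} → x ∈ β → k ≤ x → x ∸ k ∈ β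

betaCore⇒downClosed : ∀ {t β} → 1 ≤ t → BetaCore t β → DownClosed t β
betaCore⇒downClosed {t} {β} 1≤t core {x} x∈ t≤x with x ∸ t ∈? β
... | yes x∸t∈ = x∸t∈
... | no  x∸t∉ =
  contradiction (subst (t ∣_) (sym (m∸[m∸n]≡n t≤x)) ∣-refl) (core x∈ (∸-monoʳ-< 1≤t t≤x) x∸t∉)

downClosed-+ : ∀ {k m β} → DownClosed k β → DownClosed m β → DownClosed (k + m) β
downClosed-+ {k} {m} {β} dk dm {x} x∈ k+m≤x =
  subst (_∈ β) (∸-+-assoc x k m) (dm (dk x∈ (≤-trans (m≤m+n k m) k+m≤x)) m≤x∸k)
  where
  m≤x∸k : m ≤ x ∸ k
  m≤x∸k = m+n≤o⇒m≤o∸n m (≤-trans (≤-reflexive (+-comm m k)) k+m≤x)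

downClosed-* : ∀ {k β} c → DownClosed k β → DownClosed (c * k) β
downClosed-* zero    _  x∈ _ = x∈
downClosed-* (suc c) dk      = downClosed-+ dk (downClosed-* c dk)

downClosed⇒betaCore : ∀ {t β} → DownClosed t β → BetaCore t β
downClosed⇒betaCore {t} {β} dt {x} {y} x∈ y<x y∉ (divides c x∸y≡ct) =
  y∉ (subst (_∈ β) x∸ct≡y (downClosed-* c dt x∈ ct≤x))
  where
  ct≤x : c * t ≤ x
  ct≤x = subst (_≤ x) x∸y≡ct (m∸n≤m x y)
  x∸ct≡y : x ∸ c * t ≡ y
  x∸ct≡y = trans (cong (x ∸_) (sym x∸y≡ct)) (m∸[m∸n]≡n (<⇒≤ y<x))

downClosed⇒∉ : ∀ {k β} → All (λ x → 1 ≤ x) β → DownClosed k β → k ∉ β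
downClosed⇒∉ {k} {β} pos dk k∈ with All.lookup pos (subst (_∈ β) (n∸n≡0 k) (dk k∈ ≤-refl))
... | ()

isCore⇒downClosed : ∀ {t β} → 1 ≤ t → IsBetaSet β → IsCore t (partOf β) → DownClosed t β
isCore⇒downClosed {β = β} 1≤t b core = betaCore⇒downClosed 1≤t (isCore⇒betaCore β b core)

downClosed⇒isCore : ∀ {t β} → IsBetaSet β → DownClosed t β → IsCore t (partOf β)
downClosed⇒isCore {β = β} b dt = betaCore⇒isCore β b (downClosed⇒betaCore dt)

InSemigroup : ℕ → ℕ → ℕ → Set
InSemigroup u v k = ∃₂ λ a b → k ≡ a * u + b * v

downClosed-semigroup : ∀ {u v k β} → DownClosed u β → DownClosed v β → InSemigroup u v k → DownClosed k β
downClosed-semigroup du dv (a , b , refl) = downClosed-+ (downClosed-* a du) (downClosed-* b dv)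

shift⊆⇒pointwise : ∀ k β γ → Linked _>_ β → Linked _>_ γ → (∀ {x} → x ∈ β → x + k ∈ γ) →
                   length β ≤ length γ × (∀ i → i < length β → at β i + k ≤ at γ i)
shift⊆⇒pointwise k []       γ        _  _  _  = z≤n , λ _ ()
shift⊆⇒pointwise k (x ∷ xs) []       _  _  up with up (here refl)
... | ()
shift⊆⇒pointwise k (x ∷ xs) (g ∷ gs) dβ dγ up = s≤s (proj₁ rest) , pointwise
  where
  x+k≤g : x + k ≤ g
  x+k≤g = ∈-head-≤ dγ (up (here refl))
  up-tail : ∀ {y} → y ∈ xs → y + k ∈ gs
  up-tail y∈ = ∈-<head⇒∈tail (up (there y∈))
                (<-≤-trans (+-monoˡ-< k (All.lookup (below-head dβ) y∈)) x+k≤g)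
  rest : length xs ≤ length gs × (∀ i → i < length xs → at xs i + k ≤ at gs i)
  rest = shift⊆⇒pointwise k xs gs (Linked.tail dβ) (Linked.tail dγ) up-tail
  pointwise : ∀ i → i < length (x ∷ xs) → at (x ∷ xs) i + k ≤ at (g ∷ gs) i
  pointwise zero    _  = x+k≤g
  pointwise (suc i) i< = proj₂ rest i (s≤s⁻¹ i<)

length-back : ∀ k β γ → Linked _>_ β → IsBetaSet γ → (∀ {g} → g ∈ γ → k < g → g ∸ k ∈ β) →
              length γ ≤ length β + k
length-back k β [] _ _ _ = z≤n
length-back k β (g ∷ gs) dβ bγ back with g ≤? k
... | yes g≤k = ≤-trans (length<head bγ) (≤-trans g≤k (m≤n+m k (length β)))
length-back k [] (g ∷ gs) dβ bγ back | no g≰k with back (here refl) (≰⇒> g≰k)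
... | ()
length-back k (b ∷ bs) (g ∷ gs) dβ bγ back | no g≰k =
  s≤s (length-back k bs gs (Linked.tail dβ) (beta-tail bγ) back-tail)
  where
  g∸k≤b : g ∸ k ≤ b
  g∸k≤b = ∈-head-≤ dβ (back (here refl) (≰⇒> g≰k))
  back-tail : ∀ {g'} → g' ∈ gs → k < g' → g' ∸ k ∈ bs
  back-tail g'∈ k<g' = ∈-<head⇒∈tail (back (there g'∈) k<g')
    (<-≤-trans (∸-monoˡ-< (All.lookup (below-head (proj₁ bγ)) g'∈) (<⇒≤ k<g')) g∸k≤b)

partOf-at : ∀ β i → i < length β → at (partOf β) i ≡ at β i ∸ (length β ∸ suc i)
partOf-at (x ∷ xs) zero    _  = refl
partOf-at (x ∷ xs) (suc i) i< = partOf-at xs i (s≤s⁻¹ i<)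

∸-mono-shift : ∀ {a c n m} i k → a + k ≤ c → m ≤ n + k → a ∸ (n ∸ i) ≤ c ∸ (m ∸ i)
∸-mono-shift {a} {c} {n} {m} i k a+k≤c m≤n+k =
  ≤-trans (≤-reflexive (sym a+k∸≡)) (∸-mono a+k≤c m∸i≤)
  where
  a+k∸≡ : a + k ∸ (n ∸ i + k) ≡ a ∸ (n ∸ i)
  a+k∸≡ = trans (cong₂ _∸_ (+-comm a k) (+-comm (n ∸ i) k)) ([m+n]∸[m+o]≡n∸o k a (n ∸ i))
  m∸i≤ : m ∸ i ≤ n ∸ i + k
  m∸i≤ = m≤n+o⇒m∸n≤o m i
    (≤-trans m≤n+k (≤-trans (+-monoˡ-≤ k (m≤n+m∸n n i)) (≤-reflexive (+-assoc i (n ∸ i) k))))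

-- β + k ⊆ γ raises the i-th entry by k, and the converse inclusion above k keeps |γ| ≤ |β| + k,
-- so the offsets |γ| − 1 − i grow by at most k.
≺-shift : ∀ k {β γ} → Linked _>_ β → IsBetaSet γ → (∀ {x} → x ∈ β → x + k ∈ γ) →
          (∀ {g} → g ∈ γ → k < g → g ∸ k ∈ β) → β ≺ γ
≺-shift k {β} {γ} dβ bγ up back = length≤ , at≤
  where
  pw : length β ≤ length γ × (∀ i → i < length β → at β i + k ≤ at γ i)
  pw = shift⊆⇒pointwise k β γ dβ (proj₁ bγ) up
  length≤ : length (partOf β) ≤ length (partOf γ)
  length≤ = subst₂ _≤_ (sym (length-partOf β)) (sym (length-partOf γ)) (proj₁ pw)
  at≤ : ∀ i → i < length (partOf β) → at (partOf β) i ≤ at (partOf γ) i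
  at≤ i i< = subst₂ _≤_ (sym (partOf-at β i i<β)) (sym (partOf-at γ i i<γ))
               (∸-mono-shift (suc i) k (proj₂ pw i i<β) (length-back k β γ dβ bγ back))
    where
    i<β : i < length β
    i<β = subst (i <_) (length-partOf β) i<
    i<γ : i < length γ
    i<γ = <-≤-trans i<β (proj₁ pw)

combination-+ : ∀ a b c d u v → a * u + b * v + (c * u + d * v) ≡ (a + c) * u + (b + d) * v
combination-+ = solve-∀

Reach : ℕ → ℕ → ℕ → ℕ → Set
Reach u v x y = Σ ℕ λ a → Σ ℕ λ b → (a * u + b * v < x) × (y ≡ x ∸ (a * u + b * v))

reach? : ∀ {u v} → 1 ≤ u → 1 ≤ v → ∀ x y → Dec (Reach u v x y)
reach? {u} {v} 1≤u 1≤v x y =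
  map′ (λ (a , _ , b , _ , r) → a , b , r) bounded (anyUpTo? (λ a → anyUpTo? (step? a) (suc x)) (suc x))
  where
  step? : ∀ a b → Dec ((a * u + b * v < x) × (y ≡ x ∸ (a * u + b * v)))
  step? a b = (a * u + b * v <? x) ×-dec (y ≟ x ∸ (a * u + b * v))
  below : ∀ {c w} → 1 ≤ w → c * w < x → c < suc x
  below {c} 1≤w cw<x =
    s≤s (≤-trans (≤-trans (≤-reflexive (sym (*-identityʳ c))) (*-monoʳ-≤ c 1≤w)) (<⇒≤ cw<x))
  bounded : Reach u v x y →
            Σ ℕ λ a → a < suc x × Σ ℕ λ b → b < suc x × (a * u + b * v < x) × (y ≡ x ∸ (a * u + b * v))
  bounded (a , b , w<x , y≡) =
    a , below 1≤u (≤-<-trans (m≤m+n _ _) w<x) , b , below 1≤v (≤-<-trans (m≤n+m _ _) w<x) , w<x , y≡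

inClosure? : ∀ {u v} → 1 ≤ u → 1 ≤ v → ∀ L y → Dec (InClosure u v L y)
inClosure? 1≤u 1≤v L y = map′ find (λ (x , x∈ , r) → lose x∈ r) (any? (λ x → reach? 1≤u 1≤v x y) L)

inClosure-positive : ∀ {u v L y} → InClosure u v L y → 1 ≤ y
inClosure-positive (x , _ , a , b , w<x , y≡) = subst (1 ≤_) (sym y≡) (m<n⇒0<n∸m w<x)

∈⇒≤sum : ∀ {x} L → x ∈ L → x ≤ sum L
∈⇒≤sum (y ∷ ys) (here refl) = m≤m+n y (sum ys)
∈⇒≤sum (y ∷ ys) (there x∈)  = ≤-trans (∈⇒≤sum ys x∈) (m≤n+m (sum ys) y)

closure-exists : ∀ {u v} → 1 ≤ u → 1 ≤ v → ∀ L → Σ (List ℕ) (IsClosureOf u v L)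
closure-exists {u} {v} 1≤u 1≤v L = γ , (decreasing , positive) , λ y → sound , complete
  where
  γ : List ℕ
  γ = filter (inClosure? 1≤u 1≤v L) (downFrom (suc (sum L)))
  decreasing : Linked _>_ γ
  decreasing = filter⁺ (inClosure? 1≤u 1≤v L) (λ p q → <-trans q p)
                       (applyDownFrom⁺₂ (λ i → i) (suc (sum L)) (λ _ → ≤-refl))
  sound : ∀ {y} → y ∈ γ → InClosure u v L y
  sound y∈ = proj₂ (∈-filter⁻ (inClosure? 1≤u 1≤v L) y∈)
  complete : ∀ {y} → InClosure u v L y → y ∈ γ
  complete c@(x , x∈ , a , b , _ , y≡) =
    ∈-filter⁺ (inClosure? 1≤u 1≤v L) (∈-downFrom⁺ (s≤s y≤sum)) c
    where
    y≤sum : _ ≤ sum L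
    y≤sum = subst (_≤ sum L) (sym y≡) (≤-trans (m∸n≤m x (a * u + b * v)) (∈⇒≤sum L x∈))
  positive : All (λ x → 1 ≤ x) γ
  positive = All.tabulate (λ y∈ → inClosure-positive (sound y∈))

inClosure-∸ : ∀ {u v L y k} → InSemigroup u v k → InClosure u v L y → k < y → InClosure u v L (y ∸ k)
inClosure-∸ {u} {v} {y = y} (c , d , refl) (x , x∈ , a , b , w<x , y≡x∸w) k<y =
  x , x∈ , a + c , b + d , subst (_< x) (combination-+ a b c d u v) w+k<x , y∸k≡
  where
  w k : ℕ
  w = a * u + b * v
  k = c * u + d * v
  w+k<x : w + k < x
  w+k<x = subst (_< x) (+-comm k w) (m≤o∸n⇒m+n≤o (suc k) (<⇒≤ w<x) (subst (k <_) y≡x∸w k<y))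
  y∸k≡ : y ∸ k ≡ x ∸ ((a + c) * u + (b + d) * v)
  y∸k≡ = trans (cong (_∸ k) y≡x∸w) (trans (∸-+-assoc x w k) (cong (x ∸_) (combination-+ a b c d u v)))

inClosure-swap : ∀ {u v L y} → InClosure u v L y → InClosure v u L y
inClosure-swap {u} {v} (x , x∈ , a , b , w<x , y≡) =
  x , x∈ , b , a , subst (_< x) (+-comm (a * u) (b * v)) w<x , trans y≡ (cong (x ∸_) (+-comm (a * u) (b * v)))

isClosureOf-swap : ∀ {u v L γ} → IsClosureOf u v L γ → IsClosureOf v u L γ
isClosureOf-swap (bγ , mem) =
  bγ , λ y → (λ y∈ → inClosure-swap (proj₁ (mem y) y∈)) , (λ c → proj₂ (mem y) (inClosure-swap c))

closure-downClosed : ∀ {u v L γ k} → IsClosureOf u v L γ → InSemigroup u v k → k ∉ γ → DownClosed k γ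
closure-downClosed (_ , mem) S k∉ {x} x∈ k≤x with m≤n⇒m<n∨m≡n k≤x
... | inj₁ k<x  = proj₂ (mem _) (inClosure-∸ S (proj₁ (mem x) x∈) k<x)
... | inj₂ refl = contradiction x∈ k∉

semigroup-or-bottomRow : ∀ {u v z} m → 1 ≤ v → z + u ≡ m * v →
                         InSemigroup u v z ⊎ Σ ℕ λ r → 1 ≤ r × z + u + r * v ≡ u * v
semigroup-or-bottomRow {u} {suc v'} {z} m _ z+u≡mv with u ≤? m
... | yes u≤m = inj₁ (v' , m ∸ u , +-cancelʳ-≡ u z _ (begin
      z + u                        ≡⟨ z+u≡mv ⟩
      m * suc v'                   ≡⟨ cong (_* suc v') (sym (m+[n∸m]≡n u≤m)) ⟩
      (u + (m ∸ u)) * suc v'       ≡⟨ regroup u (m ∸ u) v' ⟩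
      v' * u + (m ∸ u) * suc v' + u ∎))
  where
  open ≡-Reasoning
  regroup : ∀ u r v' → (u + r) * suc v' ≡ v' * u + r * suc v' + u
  regroup = solve-∀
... | no u≰m = inj₂ (u ∸ m , m<n⇒0<n∸m (≰⇒> u≰m) , (begin
      z + u + (u ∸ m) * suc v'      ≡⟨ cong (_+ (u ∸ m) * suc v') z+u≡mv ⟩
      m * suc v' + (u ∸ m) * suc v' ≡⟨ *-distribʳ-+ (suc v') m (u ∸ m) ⟨
      (m + (u ∸ m)) * suc v'        ≡⟨ cong (_* suc v') (m+[n∸m]≡n (<⇒≤ (≰⇒> u≰m))) ⟩
      u * suc v'                    ∎))
  where open ≡-Reasoning

module ShiftClosure {u v : ℕ} (1≤u : 1 ≤ u) (1≤v : 1 ≤ v) {β : List ℕ} (bβ : IsBetaSet β)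
                    (du : DownClosed u β) (dv : DownClosed v β)
                    (bottomRow∉ : ∀ b x → 1 ≤ b → x + u + b * v ≡ u * v → x ∉ β) where

  semigroup∉ : ∀ {z} → z ∈ β → ¬ InSemigroup u v z
  semigroup∉ z∈ S = downClosed⇒∉ (proj₂ bβ) (downClosed-semigroup du dv S) z∈

  InShiftClosure : ℕ → Set
  InShiftClosure = InClosure u v (shift β u)

  inShiftClosure⇒ : ∀ {y} → InShiftClosure y →
                    Σ ℕ λ z → z ∈ β × Σ ℕ λ w → InSemigroup u v w × y + w ≡ z + u
  inShiftClosure⇒ {y} (x , x∈ , a , b , w<x , y≡) with ∈-map⁻ (_+ u) x∈
  ... | z , z∈ , refl =
    z , z∈ , a * u + b * v , (a , b , refl) , trans (cong (_+ (a * u + b * v)) y≡) (m∸n+n≡m (<⇒≤ w<x))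

  shift-⊆ : ∀ {z} → z ∈ β → InShiftClosure (z + u)
  shift-⊆ {z} z∈ = z + u , ∈-map⁺ (_+ u) z∈ , 0 , 0 , ≤-trans 1≤u (m≤n+m u z) , refl

  shift-back : ∀ {g} → InShiftClosure g → u < g → g ∸ u ∈ β
  shift-back {g} c u<g with inShiftClosure⇒ c
  ... | z , z∈ , w , S , g+w≡z+u = subst (_∈ β) z∸w≡g∸u (downClosed-semigroup du dv S z∈ w≤z)
    where
    open ≡-Reasoning
    regroup : ∀ p w u → p + w + u ≡ p + u + w
    regroup = solve-∀
    g∸u+w≡z : g ∸ u + w ≡ z
    g∸u+w≡z = +-cancelʳ-≡ u _ z (begin
      g ∸ u + w + u ≡⟨ regroup (g ∸ u) w u ⟩
      g ∸ u + u + w ≡⟨ cong (_+ w) (m∸n+n≡m (<⇒≤ u<g)) ⟩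
      g + w         ≡⟨ g+w≡z+u ⟩
      z + u         ∎)
    w≤z : w ≤ z
    w≤z = subst (w ≤_) g∸u+w≡z (m≤n+m w (g ∸ u))
    z∸w≡g∸u : z ∸ w ≡ g ∸ u
    z∸w≡g∸u = trans (cong (_∸ w) (sym g∸u+w≡z)) (m+n∸n≡m (g ∸ u) w)

  u∉ : ¬ InShiftClosure u
  u∉ c with inShiftClosure⇒ c
  ... | z , z∈ , w , S , u+w≡z+u = semigroup∉ z∈ (subst (InSemigroup u v) w≡z S)
    where
    w≡z : w ≡ z
    w≡z = +-cancelʳ-≡ u w z (trans (+-comm w u) u+w≡z+u)

  v∉ : ¬ InShiftClosure v
  v∉ c with inShiftClosure⇒ c
  ... | z , z∈ , _ , (suc a , b , refl) , eq =
    semigroup∉ z∈ (a , suc b , +-cancelʳ-≡ u z _ (trans (sym eq) (regroup a b u v)))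
    where
    regroup : ∀ a b u v → v + ((1 + a) * u + b * v) ≡ a * u + (1 + b) * v + u
    regroup = solve-∀
  ... | z , z∈ , _ , (zero , b , refl) , eq with semigroup-or-bottomRow (suc b) 1≤v (sym eq)
  ...   | inj₁ S                 = semigroup∉ z∈ S
  ...   | inj₂ (r , 1≤r , onRow) = bottomRow∉ r z 1≤r onRow z∈

  closure-properties : ∀ {γ} → IsClosureOf u v (shift β u) γ → β ≺ γ × IsSTCore u v γ
  closure-properties cl@(bγ , mem) =
    ≺-shift u (proj₁ bβ) bγ (λ z∈ → proj₂ (mem _) (shift-⊆ z∈))
                          (λ g∈ → shift-back (proj₁ (mem _) g∈)) ,
    downClosed⇒isCore bγ (closure-downClosed cl u∈S (λ u∈ → u∉ (proj₁ (mem u) u∈))) ,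
    downClosed⇒isCore bγ (closure-downClosed cl v∈S (λ v∈ → v∉ (proj₁ (mem v) v∈)))
    where
    u∈S : InSemigroup u v u
    u∈S = 1 , 0 , sym (trans (+-identityʳ (1 * u)) (*-identityˡ u))
    v∈S : InSemigroup u v v
    v∈S = 0 , 1 , sym (*-identityˡ v)

shiftClosure-isSTCore : ∀ {u v} → 1 ≤ u → 1 ≤ v → ∀ β → IsBetaSet β → IsSTCore u v β →
  (∀ b x → 1 ≤ b → x + u + b * v ≡ u * v → x ∉ β) →
  Σ (List ℕ) λ γ → IsClosureOf u v (shift β u) γ × β ≺ γ × IsSTCore u v γ
shiftClosure-isSTCore {u} {v} 1≤u 1≤v β bβ (cu , cv) bottomRow∉ =
  γ , cl , ShiftClosure.closure-properties 1≤u 1≤v bβ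
             (isCore⇒downClosed 1≤u bβ cu) (isCore⇒downClosed 1≤v bβ cv) bottomRow∉ cl
  where
  γ : List ℕ
  γ = proj₁ (closure-exists 1≤u 1≤v (shift β u))
  cl : IsClosureOf u v (shift β u) γ
  cl = proj₂ (closure-exists 1≤u 1≤v (shift β u))

mainTheorem11 : (s t : ℕ) → 1 ≤ s → s < t → Coprime s t →
    (β : List ℕ) → IsBetaSet β → IsSTCore s t β →
    ((∀ b x → 1 ≤ b → x + s + b * t ≡ s * t → x ∉ β) →
      Σ (List ℕ) λ γ → IsClosureOf s t (shift β s) γ × β ≺ γ × IsSTCore s t γ)
    ×
    ((∀ a x → 1 ≤ a → x + a * s + t ≡ s * t → x ∉ β) →
      Σ (List ℕ) λ γ → IsClosureOf s t (shift β t) γ × β ≺ γ × IsSTCore s t γ)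
mainTheorem11 s t 1≤s s<t _ β bβ (cs , ct) = shiftClosure-isSTCore 1≤s 1≤t β bβ (cs , ct) , shift-t
  where
  1≤t : 1 ≤ t
  1≤t = ≤-trans 1≤s (<⇒≤ s<t)
  regroup : ∀ x a s t → x + t + a * s ≡ x + a * s + t
  regroup = solve-∀
  shift-t : (∀ a x → 1 ≤ a → x + a * s + t ≡ s * t → x ∉ β) →
            Σ (List ℕ) λ γ → IsClosureOf s t (shift β t) γ × β ≺ γ × IsSTCore s t γ
  shift-t leftColumn∉ = swapped (shiftClosure-isSTCore 1≤t 1≤s β bβ (ct , cs) onRow∉)
    where
    onRow∉ : ∀ a x → 1 ≤ a → x + t + a * s ≡ t * s → x ∉ β
    onRow∉ a x 1≤a onRow = leftColumn∉ a x 1≤a (trans (sym (regroup x a s t)) (trans onRow (*-comm t s)))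
    swapped : (Σ (List ℕ) λ γ → IsClosureOf t s (shift β t) γ × β ≺ γ × IsSTCore t s γ) →
              Σ (List ℕ) λ γ → IsClosureOf s t (shift β t) γ × β ≺ γ × IsSTCore s t γ
    swapped (γ , cl , β≺γ , ct′ , cs′) = γ , isClosureOf-swap cl , β≺γ , cs′ , ct′
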